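{- Let $n\ge 2$ and let $D_{2n}=\langle x,y : x^2=y^n=1,\ xy=y^{ -1}x\rangle$, $H=\langle y\rangle$, $N=D_{2n}\setminus H$. Then $\mathsf{D}_{\pm}(D_{2n})\le 2\lfloor\log_2 n\rfloor+2$. Furthermore, if $S$ is a $\pm$-$1$-product sequence over $D_{2n}$ containing at least one term from $N$, then $S$ is a $1$-product sequence.
   Context: A sequence over a finite group $G$ is a finite unordered list of elements with repetition allowed. A sequence $g_1,\dots,g_\ell$ is a $1$-product sequence if $g_{\tau(1)}\cdots g_{\tau(\ell)}=1$ for some permutation $\tau$ of $\{1,\dots,\ell\}$, and a $\pm$-$1$-product sequence if $g_{\tau(1)}^{\varepsilon_1}\cdots g_{\tau(\ell)}^{\varepsilon_\ell}=1$ for some permutation $\tau$ and some signs $\varepsilon_i\in\{1,-1\}$. $\mathsf{D}_{\pm}(G)$ is the smallest integer $\ell$ such that every sequence over $G$ of length at least $\ell$ has a nonempty $\pm$-$1$-product subsequence. $\lfloor t\rfloor$ is the largest integer not exceeding $t$. -}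

module Defs where

open import Data.Bool using (Bool; true; false)
open import Data.Nat using (ℕ; _+_; _∸_; _≤_; NonZero)
open import Data.Nat.DivMod using (_mod_)
open import Data.Fin using (Fin; toℕ)
open import Data.Product using (_×_; _,_; Σ; ∃; ∃-syntax; proj₁)
open import Data.Sum using (_⊎_)
open import Data.List using (List; []; foldr; length)
open import Data.List.Membership.Propositional using (_∈_)
open import Data.List.Relation.Binary.Permutation.Propositional using (_↭_)
open import Data.List.Relation.Binary.Pointwise using (Pointwise)
open import Data.List.Relation.Binary.Sublist.Propositional using (_⊆_)
open import Relation.Binary.PropositionalEquality using (_≡_; _≢_)

-- Concrete model of the dihedral group D_{2n} of order 2n:
--   (false , k) represents y^k   (the elements of H = ⟨y⟩)
--   (true  , k) represents x y^k (the elements of N = D_{2n} ∖ H)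
-- Relations: x² = yⁿ = 1, y^a x = x y^{-a}.
module _ (n : ℕ) .{{_ : NonZero n}} where

  Dih : Set
  Dih = Bool × Fin n

  _⊕_ : Fin n → Fin n → Fin n
  a ⊕ b = (toℕ a + toℕ b) mod n

  ⊖_ : Fin n → Fin n
  ⊖ a = (n ∸ toℕ a) mod n

  one : Dih
  one = (false , 0 mod n)

  mul : Dih → Dih → Dih
  mul (false , a) (false , b) = (false , a ⊕ b)
  mul (false , a) (true  , b) = (true  , (⊖ a) ⊕ b)   -- y^a x y^b = x y^(b-a)
  mul (true  , a) (false , b) = (true  , a ⊕ b)
  mul (true  , a) (true  , b) = (false , (⊖ a) ⊕ b)   -- x y^a x y^b = y^(b-a)

  inv : Dih → Dih
  inv (false , a) = (false , ⊖ a)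
  inv (true  , a) = (true  , a)

  prod : List Dih → Dih
  prod = foldr mul one

  InN : Dih → Set
  InN g = proj₁ g ≡ true

  -- Sequences (unordered lists with repetition) are lists; orderings are permutations.
  -- S is a 1-product sequence: some ordering of S has product 1.
  OneProduct : List Dih → Set
  OneProduct S = ∃[ T ] (T ↭ S × prod T ≡ one)

  PMOneProduct : List Dih → Set
  PMOneProduct S =
    ∃[ T ] ∃[ U ] (T ↭ S × Pointwise (λ g h → h ≡ g ⊎ h ≡ inv g) T U × prod U ≡ one)

  -- every sequence of length ≥ ℓ has a nonempty ±-1-product subsequence.
  -- D±(D_{2n}) is the least such ℓ; since this property is upward closed in ℓ,
  -- "D±(D_{2n}) ≤ ℓ" is equivalent to DpmBound ℓ.
  DpmBound : ℕ → Set
  DpmBound ℓ = ∀ (S : List Dih) → ℓ ≤ length S →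
    ∃[ T ] (T ⊆ S × T ≢ [] × PMOneProduct T)

module Submission where

-- The second claim: reflections are involutions and x y^a · y^-b = y^b · x y^a, so once a
-- ±-product equal to 1 is rotated cyclically to start at a reflection, every rotation with
-- sign -1 can be moved in front of that reflection with sign +1; what remains is an
-- ordinary product of a rearrangement.
--
-- The bound: a single rotation y^a, and a pair of reflections x y^a, x y^b (whose products
-- in the two orders are y^(b-a) and y^(a-b)), are blocks whose ±-products include both y^c
-- and y^-c. A sequence of length at least 2⌊log₂ n⌋ + 2 contains k ≥ ⌊log₂ n⌋ + 1 disjoint
-- blocks, so 2^k > n and two distinct subsets of the block values c₁, …, c_k have the same
-- sum in ℤ/n. Their difference is a nontrivial signed zero sum, and the blocks it uses,
-- each taken with the matching sign, form a nonempty ±-1-product subsequence.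

open import Algebra.Bundles using (AbelianGroup; Group)
import Algebra.Consequences.Setoid as Consequences
import Algebra.Properties.AbelianGroup as AbelianGroupProperties
import Algebra.Properties.CommutativeSemigroup as CommutativeSemigroupProperties
import Algebra.Properties.Group as GroupProperties
open import Data.Bool using (true; false)
open import Data.Fin using (Fin; zero; toℕ; combine; quotient; remainder)
open import Data.Fin.Patterns using (0F; 1F)
open import Data.Fin.Properties using (toℕ-injective; toℕ-fromℕ<; toℕ<n; combine-remQuot; pigeonhole; <⇒≢)
open import Data.List using (List; []; _∷_; _++_; [_]; length)
open import Data.List.Membership.Propositional using (_∈_)
open import Data.List.Membership.Propositional.Properties using (∈-∃++)
open import Data.List.Properties using (++-conicalˡ; ++-identityʳ; length-++)
open import Data.List.Relation.Binary.Permutation.Propositional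
  using (_↭_; ↭-refl; ↭-reflexive; ↭-sym; ↭-trans; prep; swap; module PermutationReasoning)
import Data.List.Relation.Binary.Permutation.Propositional as ↭
open import Data.List.Relation.Binary.Permutation.Propositional.Properties
  using (shift; ++-comm; ∈-resp-↭; ++⁺; ↭-empty-inv; ↭-length)
open import Data.List.Relation.Binary.Pointwise as Pointwise using (Pointwise; []; _∷_)
open import Data.List.Relation.Binary.Sublist.Propositional using (_⊆_; []; _∷_; _∷ʳ_; ⊆-refl)
import Data.List.Relation.Binary.Sublist.Propositional.Properties as Sublist
open import Data.Maybe using (Maybe; nothing; just)
open import Data.Nat using (ℕ; zero; suc; _+_; _*_; _∸_; _%_; _^_; _≤_; _<_; _<?_; s≤s; z≤n; NonZero)
open import Data.Nat.DivMod using (_mod_; %-distribˡ-+; m%n%n≡m%n; m<n⇒m%n≡m; [m+n]%n≡m%n)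
open import Data.Nat.Logarithm using (⌊log₂_⌋; ⌊log₂⌋-mono-≤; ⌊log₂[2^n]⌋≡n)
open import Data.Nat.Properties
  using (+-comm; +-assoc; +-suc; *-suc; m∸n+n≡m; <⇒≤; ≤-refl; ≤-trans; +-mono-≤;
         ≮⇒≥; n≮n; +-cancelʳ-≤; *-cancelˡ-<; ^-monoʳ-≤; module ≤-Reasoning)
open import Data.Product using (_×_; _,_; ∃₂; ∃-syntax)
open import Data.Sum using (_⊎_; inj₁; inj₂; [_,_]′)
open import Data.Vec using (Vec; []; _∷_; replicate; fromList)
import Data.Vec as Vec
open import Data.Vec.Properties using (∷-injectiveˡ; ∷-injectiveʳ)
open import Function using (id; _∘_)
open import Level using (0ℓ)
open import Relation.Binary.PropositionalEquality
  using (_≡_; _≢_; refl; sym; trans; cong; cong₂; subst; isEquivalence; module ≡-Reasoning)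
import Relation.Binary.PropositionalEquality as ≡
open import Relation.Binary.Core using (REL)
open import Relation.Nullary using (yes; no; contradiction)

open import Defs

Pointwise-++⁻ : ∀ {a b r} {A : Set a} {B : Set b} {R : REL A B r} xs {ys zs} →
                Pointwise R (xs ++ ys) zs →
                ∃₂ λ xs′ ys′ → zs ≡ xs′ ++ ys′ × Pointwise R xs xs′ × Pointwise R ys ys′
Pointwise-++⁻ []       rs       = [] , _ , refl , [] , rs
Pointwise-++⁻ (x ∷ xs) (r ∷ rs) with xs′ , ys′ , refl , rs₁ , rs₂ ← Pointwise-++⁻ xs rs
  = _ ∷ xs′ , ys′ , refl , r ∷ rs₁ , rs₂

⊆-↭-transport : ∀ {a} {A : Set a} {xs ys zs : List A} → xs ⊆ ys → ys ↭ zs → ∃[ xs′ ] (xs′ ⊆ zs × xs′ ↭ xs)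
⊆-↭-transport τ                   ↭.refl       = _ , τ , ↭-refl
⊆-↭-transport (y ∷ʳ τ)            (prep y p)   with xs′ , τ′ , q ← ⊆-↭-transport τ p
  = xs′ , y ∷ʳ τ′ , q
⊆-↭-transport (refl ∷ τ)          (prep y p)   with xs′ , τ′ , q ← ⊆-↭-transport τ p
  = y ∷ xs′ , refl ∷ τ′ , prep y q
⊆-↭-transport (x ∷ʳ (y ∷ʳ τ))     (swap x y p) with xs′ , τ′ , q ← ⊆-↭-transport τ p
  = xs′ , y ∷ʳ (x ∷ʳ τ′) , q
⊆-↭-transport (x ∷ʳ (refl ∷ τ))   (swap x y p) with xs′ , τ′ , q ← ⊆-↭-transport τ p
  = y ∷ xs′ , refl ∷ (x ∷ʳ τ′) , prep y q
⊆-↭-transport (refl ∷ (y ∷ʳ τ))   (swap x y p) with xs′ , τ′ , q ← ⊆-↭-transport τ p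
  = x ∷ xs′ , y ∷ʳ (refl ∷ τ′) , prep x q
⊆-↭-transport (refl ∷ (refl ∷ τ)) (swap x y p) with xs′ , τ′ , q ← ⊆-↭-transport τ p
  = y ∷ x ∷ xs′ , refl ∷ (refl ∷ τ′) , swap y x q
⊆-↭-transport τ (↭.trans p₁ p₂) with xs₁ , τ₁ , q₁ ← ⊆-↭-transport τ p₁
                                with xs₂ , τ₂ , q₂ ← ⊆-↭-transport τ₁ p₂
  = xs₂ , τ₂ , ↭-trans q₂ q₁

n<2^[1+⌊log₂n⌋] : ∀ n → n < 2 ^ suc ⌊log₂ n ⌋
n<2^[1+⌊log₂n⌋] n with n <? 2 ^ suc ⌊log₂ n ⌋
... | yes lt = lt
... | no  ≮  =
  contradiction (subst (_≤ ⌊log₂ n ⌋) (⌊log₂[2^n]⌋≡n (suc ⌊log₂ n ⌋)) (⌊log₂⌋-mono-≤ (≮⇒≥ ≮)))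
                (n≮n ⌊log₂ n ⌋)

2*m+2≤2*n+1⇒m<n : ∀ m n → 2 * m + 2 ≤ 2 * n + 1 → m < n
2*m+2≤2*n+1⇒m<n m n le =
  *-cancelˡ-< 2 m n (+-cancelʳ-≤ 1 (suc (2 * m)) (2 * n) (subst (_≤ 2 * n + 1) (+-suc (2 * m) 1) le))

data Sign : Set where
  skip plus minus : Sign

indicator : ∀ k → Fin (2 ^ k) → Vec (Fin 2) k
indicator zero    _ = []
indicator (suc k) i = quotient {2} (2 ^ k) i ∷ indicator k (remainder {2} (2 ^ k) i)

indicator-injective : ∀ k {i j} → indicator k i ≡ indicator k j → i ≡ j
indicator-injective zero    {zero} {zero} _  = refl
indicator-injective (suc k) {i}    {j}    eq = begin
  i                                                          ≡⟨ combine-remQuot {2} (2 ^ k) i ⟨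
  combine (quotient {2} (2 ^ k) i) (remainder {2} (2 ^ k) i) ≡⟨ cong₂ combine (∷-injectiveˡ eq)
                                                                  (indicator-injective k (∷-injectiveʳ eq)) ⟩
  combine (quotient {2} (2 ^ k) j) (remainder {2} (2 ^ k) j) ≡⟨ combine-remQuot {2} (2 ^ k) j ⟩
  j                                                          ∎
  where open ≡-Reasoning

bitDifference : Fin 2 → Fin 2 → Sign
bitDifference 1F 0F = plus
bitDifference 0F 1F = minus
bitDifference _  _  = skip

difference : ∀ {k} → Vec (Fin 2) k → Vec (Fin 2) k → Vec Sign k
difference []      []      = []
difference (x ∷ u) (y ∷ v) = bitDifference x y ∷ difference u v

difference≡skips⇒≡ : ∀ {k} (u v : Vec (Fin 2) k) → difference u v ≡ replicate k skip → u ≡ v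
difference≡skips⇒≡ []       []       _  = refl
difference≡skips⇒≡ (0F ∷ u) (0F ∷ v) eq = cong (0F ∷_) (difference≡skips⇒≡ u v (∷-injectiveʳ eq))
difference≡skips⇒≡ (1F ∷ u) (1F ∷ v) eq = cong (1F ∷_) (difference≡skips⇒≡ u v (∷-injectiveʳ eq))
difference≡skips⇒≡ (0F ∷ u) (1F ∷ v) ()
difference≡skips⇒≡ (1F ∷ u) (0F ∷ v) ()

module SignedSums {a ℓ} (G : AbelianGroup a ℓ) where

  open AbelianGroup G renaming (trans to ≈-trans)
  open GroupProperties group using (identityˡ-unique)
  open CommutativeSemigroupProperties commutativeSemigroup using (interchange)
  open import Relation.Binary.Reasoning.Setoid setoid

  signed : Sign → Carrier → Carrier
  signed skip  _ = ε
  signed plus  c = c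
  signed minus c = c ⁻¹

  signedSum : ∀ {k} → Vec Sign k → Vec Carrier k → Carrier
  signedSum []      []       = ε
  signedSum (s ∷ σ) (c ∷ cs) = signed s c ∙ signedSum σ cs

  select : Fin 2 → Carrier → Carrier
  select 0F _ = ε
  select 1F c = c

  subsetSum : ∀ {k} → Vec (Fin 2) k → Vec Carrier k → Carrier
  subsetSum []      []       = ε
  subsetSum (x ∷ u) (c ∷ cs) = select x c ∙ subsetSum u cs

  signed-bitDifference : ∀ x y c → signed (bitDifference x y) c ∙ select y c ≈ select x c
  signed-bitDifference 0F 0F c = identityˡ ε
  signed-bitDifference 0F 1F c = inverseˡ c
  signed-bitDifference 1F 0F c = identityʳ c
  signed-bitDifference 1F 1F c = identityˡ c

  signedSum-difference : ∀ {k} (u v : Vec (Fin 2) k) cs →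
                         signedSum (difference u v) cs ∙ subsetSum v cs ≈ subsetSum u cs
  signedSum-difference []      []      []       = identityˡ ε
  signedSum-difference (x ∷ u) (y ∷ v) (c ∷ cs) = begin
    (signed (bitDifference x y) c ∙ signedSum (difference u v) cs) ∙ (select y c ∙ subsetSum v cs)
      ≈⟨ interchange _ _ _ _ ⟩
    (signed (bitDifference x y) c ∙ select y c) ∙ (signedSum (difference u v) cs ∙ subsetSum v cs)
      ≈⟨ ∙-cong (signed-bitDifference x y c) (signedSum-difference u v cs) ⟩
    select x c ∙ subsetSum u cs
      ∎

  zero-signedSum : ∀ {m k} (ι : Carrier → Fin m) → (∀ {x y} → ι x ≡ ι y → x ≈ y) →
                   m < 2 ^ k → (cs : Vec Carrier k) →
                   ∃[ σ ] (σ ≢ replicate k skip × signedSum σ cs ≈ ε)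
  zero-signedSum {k = k} ι ι-injective m<2^k cs
    with i , j , i<j , ιsᵢ≡ιsⱼ ← pigeonhole m<2^k (λ i → ι (subsetSum (indicator k i) cs))
    = difference u v
    , (λ trivial → <⇒≢ i<j (indicator-injective k (difference≡skips⇒≡ u v trivial)))
    , identityˡ-unique _ _ (≈-trans (signedSum-difference u v cs) (ι-injective ιsᵢ≡ιsⱼ))
    where
    u v : Vec (Fin 2) k
    u = indicator k i
    v = indicator k j
module _ (n : ℕ) .{{_ : NonZero n}} where

  toℕ-mod : ∀ m → toℕ (m mod n) ≡ m % n
  toℕ-mod m = toℕ-fromℕ< _

  mod-cong : ∀ {m k} → m % n ≡ k % n → m mod n ≡ k mod n
  mod-cong {m} {k} eq = toℕ-injective (trans (toℕ-mod m) (trans eq (sym (toℕ-mod k))))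

  mod-toℕ : ∀ (a : Fin n) → toℕ a mod n ≡ a
  mod-toℕ a = toℕ-injective (trans (toℕ-mod (toℕ a)) (m<n⇒m%n≡m (toℕ<n a)))

  mod-absorbˡ : ∀ m k → (toℕ (m mod n) + k) mod n ≡ (m + k) mod n
  mod-absorbˡ m k = mod-cong (begin
    (toℕ (m mod n) + k) % n ≡⟨ cong (λ t → (t + k) % n) (toℕ-mod m) ⟩
    (m % n + k) % n         ≡⟨ %-distribˡ-+ (m % n) k n ⟩
    (m % n % n + k % n) % n ≡⟨ cong (λ t → (t + k % n) % n) (m%n%n≡m%n m n) ⟩
    (m % n + k % n) % n     ≡⟨ %-distribˡ-+ m k n ⟨
    (m + k) % n             ∎)
    where open ≡-Reasoning

  mod-absorbʳ : ∀ m k → (m + toℕ (k mod n)) mod n ≡ (m + k) mod n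
  mod-absorbʳ m k = begin
    (m + toℕ (k mod n)) mod n ≡⟨ cong (_mod n) (+-comm m _) ⟩
    (toℕ (k mod n) + m) mod n ≡⟨ mod-absorbˡ k m ⟩
    (k + m) mod n             ≡⟨ cong (_mod n) (+-comm k m) ⟩
    (m + k) mod n             ∎
    where open ≡-Reasoning

  private
    infixl 6 _⊕ₙ_
    _⊕ₙ_ : Fin n → Fin n → Fin n
    _⊕ₙ_ = _⊕_ n

    ⊖ₙ_ : Fin n → Fin n
    ⊖ₙ_ = ⊖_ n

  ⊕-comm : ∀ a b → a ⊕ₙ b ≡ b ⊕ₙ a
  ⊕-comm a b = cong (_mod n) (+-comm (toℕ a) (toℕ b))

  ⊕-assoc : ∀ a b c → a ⊕ₙ b ⊕ₙ c ≡ a ⊕ₙ (b ⊕ₙ c)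
  ⊕-assoc a b c = begin
    (toℕ ((toℕ a + toℕ b) mod n) + toℕ c) mod n ≡⟨ mod-absorbˡ (toℕ a + toℕ b) (toℕ c) ⟩
    (toℕ a + toℕ b + toℕ c) mod n              ≡⟨ cong (_mod n) (+-assoc (toℕ a) (toℕ b) (toℕ c)) ⟩
    (toℕ a + (toℕ b + toℕ c)) mod n            ≡⟨ mod-absorbʳ (toℕ a) (toℕ b + toℕ c) ⟨
    (toℕ a + toℕ ((toℕ b + toℕ c) mod n)) mod n ∎
    where open ≡-Reasoning

  ⊕-identityˡ : ∀ a → 0 mod n ⊕ₙ a ≡ a
  ⊕-identityˡ a = trans (mod-absorbˡ 0 (toℕ a)) (mod-toℕ a)

  ⊖-inverseˡ : ∀ a → ⊖ₙ a ⊕ₙ a ≡ 0 mod n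
  ⊖-inverseˡ a = begin
    (toℕ ((n ∸ toℕ a) mod n) + toℕ a) mod n ≡⟨ mod-absorbˡ (n ∸ toℕ a) (toℕ a) ⟩
    (n ∸ toℕ a + toℕ a) mod n              ≡⟨ cong (_mod n) (m∸n+n≡m (<⇒≤ (toℕ<n a))) ⟩
    n mod n                                ≡⟨ mod-cong ([m+n]%n≡m%n 0 n) ⟩
    0 mod n                                ∎
    where open ≡-Reasoning

  ⊕-abelianGroup : AbelianGroup 0ℓ 0ℓ
  ⊕-abelianGroup = record
    { Carrier        = Fin n
    ; _≈_            = _≡_
    ; _∙_            = _⊕ₙ_
    ; ε              = 0 mod n
    ; _⁻¹            = ⊖ₙ_
    ; isAbelianGroup = record
      { isGroup = record
        { isMonoid = record
          { isSemigroup = record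
            { isMagma = record { isEquivalence = isEquivalence ; ∙-cong = cong₂ _⊕ₙ_ }
            ; assoc   = ⊕-assoc
            }
          ; identity = comm∧idˡ⇒id ⊕-comm ⊕-identityˡ
          }
        ; inverse = comm∧invˡ⇒inv ⊕-comm ⊖-inverseˡ
        ; ⁻¹-cong = cong ⊖ₙ_
        }
      ; comm = ⊕-comm
      }
    }
    where open Consequences (≡.setoid (Fin n)) using (comm∧idˡ⇒id; comm∧invˡ⇒inv)

module _ (n : ℕ) .{{_ : NonZero n}} where

  open AbelianGroup (⊕-abelianGroup n)
    using (_∙_; _⁻¹; ε; assoc; identityˡ; identityʳ; inverseˡ; inverseʳ)
  open AbelianGroupProperties (⊕-abelianGroup n) using (⁻¹-∙-comm; ε⁻¹≈ε; ⁻¹-involutive)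

  private
    ⁻¹[a∙b]∙c : ∀ a b c → (a ∙ b) ⁻¹ ∙ c ≡ a ⁻¹ ∙ (b ⁻¹ ∙ c)
    ⁻¹[a∙b]∙c a b c = trans (cong (_∙ c) (sym (⁻¹-∙-comm a b))) (assoc (a ⁻¹) (b ⁻¹) c)

    ⁻¹[a⁻¹∙b]∙c : ∀ a b c → (a ⁻¹ ∙ b) ⁻¹ ∙ c ≡ a ∙ (b ⁻¹ ∙ c)
    ⁻¹[a⁻¹∙b]∙c a b c = trans (⁻¹[a∙b]∙c (a ⁻¹) b c) (cong (_∙ (b ⁻¹ ∙ c)) (⁻¹-involutive a))

  mul-assoc : ∀ g h k → mul n (mul n g h) k ≡ mul n g (mul n h k)
  mul-assoc (false , a) (false , b) (false , c) = cong (false ,_) (assoc a b c)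
  mul-assoc (false , a) (false , b) (true  , c) = cong (true ,_)  (⁻¹[a∙b]∙c a b c)
  mul-assoc (false , a) (true  , b) (false , c) = cong (true ,_)  (assoc (a ⁻¹) b c)
  mul-assoc (false , a) (true  , b) (true  , c) = cong (false ,_) (⁻¹[a⁻¹∙b]∙c a b c)
  mul-assoc (true  , a) (false , b) (false , c) = cong (true ,_)  (assoc a b c)
  mul-assoc (true  , a) (false , b) (true  , c) = cong (false ,_) (⁻¹[a∙b]∙c a b c)
  mul-assoc (true  , a) (true  , b) (false , c) = cong (false ,_) (assoc (a ⁻¹) b c)
  mul-assoc (true  , a) (true  , b) (true  , c) = cong (true ,_)  (⁻¹[a⁻¹∙b]∙c a b c)

  mul-identityˡ : ∀ g → mul n (one n) g ≡ g
  mul-identityˡ (false , a) = cong (false ,_) (identityˡ a)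
  mul-identityˡ (true  , a) = cong (true ,_) (trans (cong (_∙ a) ε⁻¹≈ε) (identityˡ a))

  mul-identityʳ : ∀ g → mul n g (one n) ≡ g
  mul-identityʳ (false , a) = cong (false ,_) (identityʳ a)
  mul-identityʳ (true  , a) = cong (true ,_) (identityʳ a)

  inv-inverseˡ : ∀ g → mul n (inv n g) g ≡ one n
  inv-inverseˡ (false , a) = cong (false ,_) (inverseˡ a)
  inv-inverseˡ (true  , a) = cong (false ,_) (inverseˡ a)

  inv-inverseʳ : ∀ g → mul n g (inv n g) ≡ one n
  inv-inverseʳ (false , a) = cong (false ,_) (inverseʳ a)
  inv-inverseʳ (true  , a) = cong (false ,_) (inverseˡ a)

  dihedral-group : Group 0ℓ 0ℓ
  dihedral-group = record
    { Carrier = Dih n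
    ; _≈_     = _≡_
    ; _∙_     = mul n
    ; ε       = one n
    ; _⁻¹     = inv n
    ; isGroup = record
      { isMonoid = record
        { isSemigroup = record
          { isMagma = record { isEquivalence = isEquivalence ; ∙-cong = cong₂ (mul n) }
          ; assoc   = mul-assoc
          }
        ; identity = mul-identityˡ , mul-identityʳ
        }
      ; inverse = inv-inverseˡ , inv-inverseʳ
      ; ⁻¹-cong = cong (inv n)
      }
    }

module _ (n : ℕ) .{{_ : NonZero n}} where

  open Group (dihedral-group n) using (_∙_; _⁻¹; ε; assoc; identityˡ; identityʳ; inverseʳ)
  open GroupProperties (dihedral-group n) using (inverseˡ-unique; ⁻¹-anti-homo-∙)
  open SignedSums (⊕-abelianGroup n) using (signedSum; zero-signedSum)

  y^_ xy^_ : Fin n → Dih n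
  y^ a  = false , a
  xy^ a = true , a

  prod-++ : ∀ A B → prod n (A ++ B) ≡ prod n A ∙ prod n B
  prod-++ []      B = sym (identityˡ (prod n B))
  prod-++ (g ∷ A) B = trans (cong (g ∙_) (prod-++ A B)) (sym (assoc g (prod n A) (prod n B)))

  prod-rotate : ∀ A B → prod n (A ++ B) ≡ ε → prod n (B ++ A) ≡ ε
  prod-rotate A B AB≡ε = begin
    prod n (B ++ A)        ≡⟨ prod-++ B A ⟩
    prod n B ∙ prod n A    ≡⟨ cong (prod n B ∙_) (inverseˡ-unique _ _ (trans (sym (prod-++ A B)) AB≡ε)) ⟩
    prod n B ∙ prod n B ⁻¹ ≡⟨ inverseʳ (prod n B) ⟩
    ε                      ∎
    where open ≡-Reasoning

  Signed : Dih n → Dih n → Set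
  Signed g h = h ≡ g ⊎ h ≡ g ⁻¹

  Realizes : List (Dih n) → Dih n → Set
  Realizes S h = ∃[ T ] ∃[ U ] (T ↭ S × Pointwise Signed T U × prod n U ≡ h)

  realizes-[] : Realizes [] ε
  realizes-[] = [] , [] , ↭-refl , [] , refl

  realizes-++ : ∀ {A B g h} → Realizes A g → Realizes B h → Realizes (A ++ B) (g ∙ h)
  realizes-++ (T₁ , U₁ , T₁↭A , T₁∼U₁ , U₁≡g) (T₂ , U₂ , T₂↭B , T₂∼U₂ , U₂≡h) =
    T₁ ++ T₂ , U₁ ++ U₂ , ++⁺ T₁↭A T₂↭B , Pointwise.++⁺ T₁∼U₁ T₂∼U₂ ,
    trans (prod-++ U₁ U₂) (cong₂ _∙_ U₁≡g U₂≡h)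

  realizes-↭ : ∀ {A B g} → A ↭ B → Realizes A g → Realizes B g
  realizes-↭ A↭B (T , U , T↭A , T∼U , U≡g) = T , U , ↭-trans T↭A A↭B , T∼U , U≡g

  realizes-[g] : ∀ g → Realizes [ g ] g
  realizes-[g] g = [ g ] , [ g ] , ↭-refl , inj₁ refl ∷ [] , identityʳ g

  realizes-[g]⁻¹ : ∀ g → Realizes [ g ] (g ⁻¹)
  realizes-[g]⁻¹ g = [ g ] , [ g ⁻¹ ] , ↭-refl , inj₂ refl ∷ [] , identityʳ (g ⁻¹)

  realizes-[g,h] : ∀ g h → Realizes (g ∷ h ∷ []) (g ∙ h)
  realizes-[g,h] g h = realizes-++ (realizes-[g] g) (realizes-[g] h)

  reflection-conjugates : ∀ a b → xy^ a ∙ (y^ b) ⁻¹ ≡ y^ b ∙ xy^ a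
  reflection-conjugates a b = cong (true ,_) (⊕-comm n a (⊖_ n b))

  signed-reflection : ∀ {a h} → Signed (xy^ a) h → h ≡ xy^ a
  signed-reflection = [ id , id ]′

  reflection-absorbs-signs : ∀ {W W′} → Pointwise Signed W W′ → ∀ a →
    ∃₂ λ L R → L ++ R ↭ W × xy^ a ∙ prod n W′ ≡ prod n L ∙ (xy^ a ∙ prod n R)
  reflection-absorbs-signs [] a = [] , [] , ↭-refl , sym (identityˡ _)
  reflection-absorbs-signs (_∷_ {x = true , b} {ys = W′} s ss) a
    with refl ← signed-reflection s
    with L , R , LR↭W , eq ← reflection-absorbs-signs ss b
    = [] , L ++ xy^ b ∷ R , ↭-trans (shift (xy^ b) L R) (prep (xy^ b) LR↭W) , (begin
      xy^ a ∙ (xy^ b ∙ prod n W′)             ≡⟨ cong (xy^ a ∙_) eq ⟩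
      xy^ a ∙ (prod n L ∙ (xy^ b ∙ prod n R)) ≡⟨ cong (xy^ a ∙_) (prod-++ L (xy^ b ∷ R)) ⟨
      xy^ a ∙ prod n (L ++ xy^ b ∷ R)         ≡⟨ identityˡ _ ⟨
      ε ∙ (xy^ a ∙ prod n (L ++ xy^ b ∷ R))   ∎)
    where open ≡-Reasoning
  reflection-absorbs-signs (_∷_ {x = false , b} {ys = W′} (inj₁ refl) ss) a
    with L , R , LR↭W , eq ← reflection-absorbs-signs ss (_⊕_ n a b)
    = L , y^ b ∷ R , ↭-trans (shift (y^ b) L R) (prep (y^ b) LR↭W) , (begin
      xy^ a ∙ (y^ b ∙ prod n W′)             ≡⟨ assoc (xy^ a) (y^ b) _ ⟨
      (xy^ a ∙ y^ b) ∙ prod n W′             ≡⟨ eq ⟩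
      prod n L ∙ ((xy^ a ∙ y^ b) ∙ prod n R) ≡⟨ cong (prod n L ∙_) (assoc (xy^ a) (y^ b) _) ⟩
      prod n L ∙ (xy^ a ∙ (y^ b ∙ prod n R)) ∎)
    where open ≡-Reasoning
  reflection-absorbs-signs (_∷_ {x = false , b} {ys = W′} (inj₂ refl) ss) a
    with L , R , LR↭W , eq ← reflection-absorbs-signs ss a
    = y^ b ∷ L , R , prep (y^ b) LR↭W , (begin
      xy^ a ∙ ((y^ b) ⁻¹ ∙ prod n W′)        ≡⟨ assoc (xy^ a) _ _ ⟨
      (xy^ a ∙ (y^ b) ⁻¹) ∙ prod n W′        ≡⟨ cong (_∙ prod n W′) (reflection-conjugates a b) ⟩
      (y^ b ∙ xy^ a) ∙ prod n W′             ≡⟨ assoc (y^ b) (xy^ a) _ ⟩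
      y^ b ∙ (xy^ a ∙ prod n W′)             ≡⟨ cong (y^ b ∙_) eq ⟩
      y^ b ∙ (prod n L ∙ (xy^ a ∙ prod n R)) ≡⟨ assoc (y^ b) (prod n L) _ ⟨
      (y^ b ∙ prod n L) ∙ (xy^ a ∙ prod n R) ∎)
    where open ≡-Reasoning

  pm-one-product⇒one-product : ∀ S → PMOneProduct n S → ∃[ g ] (g ∈ S × InN n g) → OneProduct n S
  pm-one-product⇒one-product S (T , U , T↭S , T∼U , U≡ε) ((true , a) , g∈S , refl)
    with A , B , refl ← ∈-∃++ (∈-resp-↭ (↭-sym T↭S) g∈S)
    with A′ , _ , refl , A∼A′ , s ∷ B∼B′ ← Pointwise-++⁻ A T∼U
    with refl ← signed-reflection s
    with L , R , LR↭BA , eq ← reflection-absorbs-signs (Pointwise.++⁺ B∼B′ A∼A′) a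
    = L ++ xy^ a ∷ R , L[a]R↭S , trans (prod-++ L (xy^ a ∷ R)) (trans (sym eq) (prod-rotate A′ _ U≡ε))
    where
    open PermutationReasoning
    L[a]R↭S : L ++ xy^ a ∷ R ↭ S
    L[a]R↭S = begin
      L ++ xy^ a ∷ R ↭⟨ shift (xy^ a) L R ⟩
      xy^ a ∷ L ++ R ↭⟨ prep (xy^ a) LR↭BA ⟩
      xy^ a ∷ B ++ A ↭⟨ ++-comm (xy^ a ∷ B) A ⟩
      A ++ xy^ a ∷ B ↭⟨ T↭S ⟩
      S              ∎

  record Block : Set where
    field
      elems            : List (Dih n)
      elems≢[]         : elems ≢ []
      size≤2           : length elems ≤ 2
      value            : Fin n
      realizes-value   : Realizes elems (y^ value)
      realizes-value⁻¹ : Realizes elems ((y^ value) ⁻¹)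
  open Block

  rotationBlock : Fin n → Block
  rotationBlock a = record
    { elems            = [ y^ a ]
    ; elems≢[]         = λ ()
    ; size≤2           = s≤s z≤n
    ; value            = a
    ; realizes-value   = realizes-[g] (y^ a)
    ; realizes-value⁻¹ = realizes-[g]⁻¹ (y^ a)
    }

  reflectionPairBlock : Fin n → Fin n → Block
  reflectionPairBlock a b = record
    { elems            = g ∷ h ∷ []
    ; elems≢[]         = λ ()
    ; size≤2           = ≤-refl
    ; value            = _⊕_ n (⊖_ n a) b
    ; realizes-value   = realizes-[g,h] g h
    ; realizes-value⁻¹ = subst (Realizes (g ∷ h ∷ [])) (sym (⁻¹-anti-homo-∙ g h))
                          (realizes-↭ (swap h g ↭-refl) (realizes-[g,h] h g))
    }
    where
    g h : Dih n
    g = xy^ a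
    h = xy^ b

  elemsOf : ∀ {k} → Vec Block k → List (Dih n)
  elemsOf []       = []
  elemsOf (b ∷ bs) = elems b ++ elemsOf bs

  length-elemsOf : ∀ {k} (bs : Vec Block k) → length (elemsOf bs) ≤ 2 * k
  length-elemsOf []                   = z≤n
  length-elemsOf {k = suc k} (b ∷ bs) = begin
    length (elems b ++ elemsOf bs)         ≡⟨ length-++ (elems b) ⟩
    length (elems b) + length (elemsOf bs) ≤⟨ +-mono-≤ (size≤2 b) (length-elemsOf bs) ⟩
    2 + 2 * k                              ≡⟨ *-suc 2 k ⟨
    2 * suc k                              ∎
    where open ≤-Reasoning

  selection : ∀ {k} → Vec Sign k → Vec Block k → List (Dih n)
  selection []          []       = []
  selection (skip  ∷ σ) (b ∷ bs) = selection σ bs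
  selection (plus  ∷ σ) (b ∷ bs) = elems b ++ selection σ bs
  selection (minus ∷ σ) (b ∷ bs) = elems b ++ selection σ bs

  selection-⊆ : ∀ {k} (σ : Vec Sign k) bs → selection σ bs ⊆ elemsOf bs
  selection-⊆ []          []       = []
  selection-⊆ (skip  ∷ σ) (b ∷ bs) = Sublist.++⁺ˡ (elems b) (selection-⊆ σ bs)
  selection-⊆ (plus  ∷ σ) (b ∷ bs) = Sublist.++⁺ ⊆-refl (selection-⊆ σ bs)
  selection-⊆ (minus ∷ σ) (b ∷ bs) = Sublist.++⁺ ⊆-refl (selection-⊆ σ bs)

  selection≢[] : ∀ {k} (σ : Vec Sign k) bs → σ ≢ replicate k skip → selection σ bs ≢ []
  selection≢[] []          []       σ≢0 _ = σ≢0 refl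
  selection≢[] (skip  ∷ σ) (b ∷ bs) σ≢0   = selection≢[] σ bs (σ≢0 ∘ cong (skip ∷_))
  selection≢[] (plus  ∷ σ) (b ∷ bs) _     = elems≢[] b ∘ ++-conicalˡ (elems b) _
  selection≢[] (minus ∷ σ) (b ∷ bs) _     = elems≢[] b ∘ ++-conicalˡ (elems b) _

  realizes-selection : ∀ {k} (σ : Vec Sign k) bs →
                       Realizes (selection σ bs) (y^ (signedSum σ (Vec.map value bs)))
  realizes-selection []          []       = realizes-[]
  realizes-selection (skip  ∷ σ) (b ∷ bs) = realizes-++ realizes-[] (realizes-selection σ bs)
  realizes-selection (plus  ∷ σ) (b ∷ bs) = realizes-++ (realizes-value b) (realizes-selection σ bs)
  realizes-selection (minus ∷ σ) (b ∷ bs) = realizes-++ (realizes-value⁻¹ b) (realizes-selection σ bs)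

  unpairedList : Maybe (Fin n) → List (Dih n)
  unpairedList nothing  = []
  unpairedList (just a) = [ xy^ a ]

  -- The Maybe argument holds a reflection still waiting for a partner.
  blocks : Maybe (Fin n) → List (Dih n) → List Block
  blocks _        []                = []
  blocks p        ((false , a) ∷ S) = rotationBlock a ∷ blocks p S
  blocks nothing  ((true  , a) ∷ S) = blocks (just a) S
  blocks (just b) ((true  , a) ∷ S) = reflectionPairBlock b a ∷ blocks nothing S

  unpaired : Maybe (Fin n) → List (Dih n) → Maybe (Fin n)
  unpaired p        []                = p
  unpaired p        ((false , a) ∷ S) = unpaired p S
  unpaired nothing  ((true  , a) ∷ S) = unpaired (just a) S
  unpaired (just b) ((true  , a) ∷ S) = unpaired nothing S

  blocks-↭ : ∀ p S → elemsOf (fromList (blocks p S)) ++ unpairedList (unpaired p S) ↭ unpairedList p ++ S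
  blocks-↭ p        []                = ↭-reflexive (sym (++-identityʳ (unpairedList p)))
  blocks-↭ p        ((false , a) ∷ S) =
    ↭-trans (prep (y^ a) (blocks-↭ p S)) (↭-sym (shift (y^ a) (unpairedList p) S))
  blocks-↭ nothing  ((true  , a) ∷ S) = blocks-↭ (just a) S
  blocks-↭ (just b) ((true  , a) ∷ S) = prep _ (prep _ (blocks-↭ nothing S))

  length≤2*blocks+1 : ∀ S → length S ≤ 2 * length (blocks nothing S) + 1
  length≤2*blocks+1 S = begin
    length S                                      ≡⟨ ↭-length (blocks-↭ nothing S) ⟨
    length (elemsOf bs ++ unpairedList q)         ≡⟨ length-++ (elemsOf bs) ⟩
    length (elemsOf bs) + length (unpairedList q) ≤⟨ +-mono-≤ (length-elemsOf bs) (length-unpairedList q) ⟩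
    2 * length (blocks nothing S) + 1             ∎
    where
    open ≤-Reasoning
    bs : Vec Block (length (blocks nothing S))
    bs = fromList (blocks nothing S)
    q : Maybe (Fin n)
    q = unpaired nothing S
    length-unpairedList : ∀ p → length (unpairedList p) ≤ 1
    length-unpairedList nothing  = z≤n
    length-unpairedList (just _) = ≤-refl

  zero-sum-selection : ∀ {k} (bs : Vec Block k) → n < 2 ^ k →
                       ∃[ σ ] (selection σ bs ≢ [] × Realizes (selection σ bs) ε)
  zero-sum-selection bs n<2^k with σ , σ≢0 , Σσ≡0 ← zero-signedSum id id n<2^k (Vec.map value bs)
    = σ , selection≢[] σ bs σ≢0 , subst (Realizes (selection σ bs)) (cong y^_ Σσ≡0) (realizes-selection σ bs)

  pm-one-product-subsequence : ∀ {k} (bs : Vec Block k) {R S} → elemsOf bs ++ R ↭ S → n < 2 ^ k →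
                               ∃[ T ] (T ⊆ S × T ≢ [] × PMOneProduct n T)
  pm-one-product-subsequence bs bs+R↭S n<2^k
    with σ , sel≢[] , sel-realizes ← zero-sum-selection bs n<2^k
    with T , T⊆S , T↭sel ← ⊆-↭-transport (Sublist.++⁺ʳ _ (selection-⊆ σ bs)) bs+R↭S
    = T , T⊆S , (λ { refl → sel≢[] (↭-empty-inv (↭-sym T↭sel)) }) , realizes-↭ (↭-sym T↭sel) sel-realizes

  n<2^#blocks : ∀ S → 2 * ⌊log₂ n ⌋ + 2 ≤ length S → n < 2 ^ length (blocks nothing S)
  n<2^#blocks S bound = begin-strict
    n                 <⟨ n<2^[1+⌊log₂n⌋] n ⟩
    2 ^ suc ⌊log₂ n ⌋ ≤⟨ ^-monoʳ-≤ 2 (2*m+2≤2*n+1⇒m<n ⌊log₂ n ⌋ k (≤-trans bound (length≤2*blocks+1 S))) ⟩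
    2 ^ k             ∎
    where
    open ≤-Reasoning
    k : ℕ
    k = length (blocks nothing S)

  dpm-bound : DpmBound n (2 * ⌊log₂ n ⌋ + 2)
  dpm-bound S bound =
    pm-one-product-subsequence (fromList (blocks nothing S)) (blocks-↭ nothing S) (n<2^#blocks S bound)

-- The argument does not need 2 ≤ n.
lemma2p7 : (n : ℕ) .{{_ : NonZero n}} → 2 ≤ n →
    DpmBound n (2 * ⌊log₂ n ⌋ + 2)
    × (∀ (S : List (Dih n)) → PMOneProduct n S → (∃[ g ] (g ∈ S × InN n g)) → OneProduct n S)
lemma2p7 n _ = dpm-bound n , pm-one-product⇒one-product n
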